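{- Let $R$ be a tolerance on $U$ induced by an irredundant covering of $U$, and let $x\in U$ be such that $R(x)$ is a block. The following are equivalent: (a) $R(y)=R(x)$ for all $y\in R(x)$; (b) $(R(x)^{\downarrow},R(x)^{\uparrow})=(R(x),R(x))$; (c) either $R(x)=\{x\}$, or $(\emptyset,R(x))$ is the only atom of $\mathit{RS}$ below $(R(x)^{\downarrow},R(x)^{\uparrow})$.
   Context: A tolerance on $U$ is a reflexive symmetric relation; $R(x)=\{y\mid x\,R\,y\}$; $X^{\downarrow}=\{x\mid R(x)\subseteq X\}$, $X^{\uparrow}=\{x\mid R(x)\cap X\neq\emptyset\}$. A block of $R$ is a maximal nonempty $X$ with $X\times X\subseteq R$. A covering is a family of nonempty subsets of $U$ with union $U$, irredundant if no member can be removed keeping a covering; its induced tolerance is $\bigcup\{X\times X\mid X\in\mathcal{H}\}$. $\mathit{RS}=\{(X^{\downarrow},X^{\uparrow})\mid X\subseteq U\}$ ordered coordinatewise, with least element $(\emptyset,\emptyset)$; an atom is an element covering the least element. -}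

module Defs where

open import Level using (0ℓ)
open import Data.Product using (Σ; ∃; _×_; _,_)
open import Data.Sum using (_⊎_)
open import Data.Empty using (⊥)
open import Relation.Nullary using (¬_)
open import Relation.Binary.PropositionalEquality using (_≡_)

Subset : Set → Set₁
Subset U = U → Set

module _ {U : Set} where

  infix 4 _∈_ _⊆_ _≐_ _≤ₚ_ _≐ₚ_ _<ₚ_
  infix 9 _⟨_⟩ _↓[_] _↑[_]

  _∈_ : U → Subset U → Set
  x ∈ X = X x

  _⊆_ : Subset U → Subset U → Set
  X ⊆ Y = ∀ u → u ∈ X → u ∈ Y

  _≐_ : Subset U → Subset U → Set
  X ≐ Y = (X ⊆ Y) × (Y ⊆ X)

  ∅ : Subset U
  ∅ _ = ⊥

  ｛_｝ : U → Subset U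
  ｛ x ｝ y = y ≡ x

  Nonempty : Subset U → Set
  Nonempty X = ∃ λ u → u ∈ X

  _⟨_⟩ : (U → U → Set) → U → Subset U
  R ⟨ x ⟩ = λ y → R x y

  _↓[_] : Subset U → (U → U → Set) → Subset U
  X ↓[ R ] = λ x → R ⟨ x ⟩ ⊆ X

  _↑[_] : Subset U → (U → U → Set) → Subset U
  X ↑[ R ] = λ x → ∃ λ y → y ∈ R ⟨ x ⟩ × y ∈ X

  Clique : (U → U → Set) → Subset U → Set
  Clique R X = ∀ a b → a ∈ X → b ∈ X → R a b

  IsBlock : (U → U → Set) → Subset U → Set₁
  IsBlock R X = Nonempty X × Clique R X
              × (∀ (Y : Subset U) → X ⊆ Y → Clique R Y → Y ⊆ X)

  IsCovering : {I : Set} → (I → Subset U) → Set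
  IsCovering {I} H = (∀ i → Nonempty (H i)) × (∀ u → ∃ λ i → u ∈ H i)

  -- irredundant: no member can be removed while keeping a covering
  IsIrredundantCovering : {I : Set} → (I → Subset U) → Set
  IsIrredundantCovering {I} H =
    IsCovering H × (∀ i → ¬ (∀ u → ∃ λ j → ¬ (j ≡ i) × u ∈ H j))

  induced : {I : Set} → (I → Subset U) → U → U → Set
  induced {I} H x y = ∃ λ i → x ∈ H i × y ∈ H i

  Pair : Set₁
  Pair = Subset U × Subset U

  _≤ₚ_ : Pair → Pair → Set
  (A , B) ≤ₚ (C , D) = (A ⊆ C) × (B ⊆ D)

  _≐ₚ_ : Pair → Pair → Set
  (A , B) ≐ₚ (C , D) = (A ≐ C) × (B ≐ D)

  _<ₚ_ : Pair → Pair → Set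
  p <ₚ q = (p ≤ₚ q) × ¬ (p ≐ₚ q)

  InRS : (U → U → Set) → Pair → Set₁
  InRS R (A , B) = Σ (Subset U) λ X → (A ≐ (X ↓[ R ])) × (B ≐ (X ↑[ R ]))

  ⊥RS : Pair
  ⊥RS = (∅ , ∅)

  IsAtom : (U → U → Set) → Pair → Set₁
  IsAtom R a = InRS R a × (⊥RS <ₚ a)
             × ¬ (Σ Pair λ b → InRS R b × (⊥RS <ₚ b) × (b <ₚ a))

-- Both (a) and (b) amount to R(x)↑ ⊆ R(x), because R(x) is a clique.
-- An element (P , Q) of RS above the bottom is generated by a nonempty set Y, so Q ⊇ Y↑
-- contains the neighbourhood of a point of Y; hence if Q lies inside a clique S it is all of S.
-- So the only atom of RS below (S↓ , S↑) for an upper-closed clique S is (∅ , S), and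
-- (∅ , R(x)) is an atom as soon as R(x) ≠ {x}, being generated by {x}. Conversely, in the
-- induced tolerance of an irredundant covering every member H i has a point z lying in no other
-- member, so R(z) = H i and (∅ , H i) is an atom unless H i is a singleton. If (∅ , R(x)) is
-- the only atom below (R(x)↓ , R(x)↑), every member meeting R(x) therefore lies inside R(x),
-- which is R(x)↑ ⊆ R(x).
module Submission where

open import Defs
open import Level using (0ℓ)
open import Axiom.ExcludedMiddle using (ExcludedMiddle)
open import Axiom.DoubleNegationElimination using (em⇒dne)
open import Data.Product using (_×_; _,_; Σ; ∃; proj₁; proj₂)
open import Data.Sum using (_⊎_; inj₁; inj₂)
import Data.Sum as Sum
open import Function.Base using (_∘_)
open import Function.Bundles using (_⇔_; mk⇔)
open import Relation.Nullary using (¬_; yes; no)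
open import Relation.Binary.PropositionalEquality using (_≡_; refl; sym; trans; subst)

module _ {U : Set} where

  ≐-sym : {X Y : Subset U} → X ≐ Y → Y ≐ X
  ≐-sym (X⊆Y , Y⊆X) = Y⊆X , X⊆Y

  ≐-trans : {X Y Z : Subset U} → X ≐ Y → Y ≐ Z → X ≐ Z
  ≐-trans (X⊆Y , Y⊆X) (Y⊆Z , Z⊆Y) = (λ u → Y⊆Z u ∘ X⊆Y u) , (λ u → Y⊆X u ∘ Z⊆Y u)

  InRS-resp-upper : {R : U → U → Set} {A B B′ : Subset U} →
                    B′ ≐ B → InRS R (A , B) → InRS R (A , B′)
  InRS-resp-upper B′≐B (Y , A≐ , B≐) = Y , A≐ , ≐-trans B′≐B B≐

module Tolerance {U : Set} (R : U → U → Set)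
                 (R-refl : ∀ u → R u u) (R-sym : ∀ {u v} → R u v → R v u) where

  approx : Subset U → Pair
  approx X = X ↓[ R ] , X ↑[ R ]

  Exact : Subset U → Set
  Exact X = approx X ≐ₚ (X , X)

  UpperClosed : Subset U → Set
  UpperClosed X = X ↑[ R ] ⊆ X

  UniqueAtomBelow : Pair → Pair → Set₁
  UniqueAtomBelow a q = IsAtom R a × a ≤ₚ q × (∀ p → IsAtom R p → p ≤ₚ q → p ≐ₚ a)

  ↓-⊆ : (X : Subset U) → X ↓[ R ] ⊆ X
  ↓-⊆ X z z↓ = z↓ z (R-refl z)

  ⊆-↑ : (X : Subset U) → X ⊆ X ↑[ R ]
  ⊆-↑ X z zX = z , R-refl z , zX

  upperClosed⇒exact : {X : Subset U} → UpperClosed X → Exact X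
  upperClosed⇒exact {X} closed =
    (↓-⊆ X , λ z zX u zu → closed u (z , R-sym zu , zX)) , (closed , ⊆-↑ X)

  exact⇒upperClosed : {X : Subset U} → Exact X → UpperClosed X
  exact⇒upperClosed (_ , closed , _) = closed

  neighbours-equal⇒upperClosed : {x : U} →
    (∀ y → y ∈ R ⟨ x ⟩ → R ⟨ y ⟩ ≐ R ⟨ x ⟩) → UpperClosed (R ⟨ x ⟩)
  neighbours-equal⇒upperClosed equal z (y , zy , xy) = proj₁ (equal y xy) z (R-sym zy)

  upperClosed⇒neighbours-equal : {x : U} → Clique R (R ⟨ x ⟩) →
    UpperClosed (R ⟨ x ⟩) → ∀ y → y ∈ R ⟨ x ⟩ → R ⟨ y ⟩ ≐ R ⟨ x ⟩
  upperClosed⇒neighbours-equal {x} clique closed y xy =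
    (λ z yz → closed z (y , R-sym yz , xy)) , (λ z xz → clique y z xy xz)

  singleton-upperClosed : {x : U} → R ⟨ x ⟩ ≐ ｛ x ｝ → UpperClosed (R ⟨ x ⟩)
  singleton-upperClosed (⊆x , _) z (y , zy , xy) with ⊆x y xy
  ... | refl = R-sym zy

  ↑-singleton : (x : U) → R ⟨ x ⟩ ≐ ｛ x ｝ ↑[ R ]
  ↑-singleton x = (λ z xz → x , R-sym xz , refl) , λ { z (_ , zx , refl) → R-sym zx }

  ↓-singleton : {x : U} → ¬ (R ⟨ x ⟩ ≐ ｛ x ｝) → ∅ ≐ ｛ x ｝ ↓[ R ]
  ↓-singleton {x} R⟨x⟩≠｛x｝ = (λ _ ()) , x↓⇒⊥
    where
      x↓⇒⊥ : ∀ u → u ∈ ｛ x ｝ ↓[ R ] → u ∈ ∅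
      x↓⇒⊥ u u↓ with u↓ u (R-refl u)
      ... | refl = R⟨x⟩≠｛x｝ (u↓ , λ { _ refl → R-refl u })

  neighbourhood∈RS : {x : U} → ¬ (R ⟨ x ⟩ ≐ ｛ x ｝) → InRS R (∅ , R ⟨ x ⟩)
  neighbourhood∈RS {x} R⟨x⟩≠｛x｝ = ｛ x ｝ , ↓-singleton R⟨x⟩≠｛x｝ , ↑-singleton x

  module _ (em : ExcludedMiddle 0ℓ) where

    generator-nonempty : {A B Y : Subset U} →
      A ≐ Y ↓[ R ] → B ≐ Y ↑[ R ] → ⊥RS <ₚ (A , B) → Nonempty Y
    generator-nonempty {Y = Y} (A⊆ , _) (B⊆ , _) (_ , nonzero) = em⇒dne em λ empty →
      let A⊆∅ z zA = empty (z , ↓-⊆ Y z (A⊆ z zA))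
          B⊆∅ z zB = let (_ , _ , tY) = B⊆ z zB in empty (_ , tY)
      in nonzero (((λ _ ()) , A⊆∅) , ((λ _ ()) , B⊆∅))

    upper⊆clique⇒clique⊆upper : {S A B : Subset U} → Clique R S →
      InRS R (A , B) → ⊥RS <ₚ (A , B) → B ⊆ S → S ⊆ B
    upper⊆clique⇒clique⊆upper clique (Y , A≐ , B≐@(_ , ⊆B)) nonzero B⊆S u uS =
      let (v , vY) = generator-nonempty A≐ B≐ nonzero
      in ⊆B u (v , clique u v uS (B⊆S v (⊆B v (⊆-↑ Y v vY))) , vY)

    ∅-clique-isAtom : {S : Subset U} → Clique R S → Nonempty S → InRS R (∅ , S) →
                      IsAtom R (∅ , S)
    ∅-clique-isAtom {S} clique (s , sS) S∈RS = S∈RS , ⊥<∅,S , nothing-between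
      where
        ⊥<∅,S : ⊥RS <ₚ (∅ , S)
        ⊥<∅,S = ((λ _ ()) , (λ _ ())) , λ (_ , _ , S⊆∅) → S⊆∅ s sS

        nothing-between : ¬ (Σ Pair λ b → InRS R b × (⊥RS <ₚ b) × (b <ₚ (∅ , S)))
        nothing-between ((A , B) , b∈RS , ⊥<b , ((A⊆∅ , B⊆S) , b≠∅,S)) =
          b≠∅,S ((A⊆∅ , λ _ ()) , (B⊆S , upper⊆clique⇒clique⊆upper clique b∈RS ⊥<b B⊆S))

    atom-upper⊆clique⇒≐ : {S P Q : Subset U} → Clique R S →
      IsAtom R (∅ , S) → IsAtom R (P , Q) → Q ⊆ S → (P , Q) ≐ₚ (∅ , S)
    atom-upper⊆clique⇒≐ clique (S∈RS , ⊥<∅,S , _) (p∈RS , ⊥<p , nothing-between) Q⊆S =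
      (P⊆∅ , λ _ ()) , (Q⊆S , S⊆Q)
      where
        S⊆Q = upper⊆clique⇒clique⊆upper clique p∈RS ⊥<p Q⊆S
        P⊆∅ = λ z zP → nothing-between
          ((∅ , _) , S∈RS , ⊥<∅,S , ((λ _ ()) , S⊆Q) , λ ((_ , P⊆∅) , _) → P⊆∅ z zP)

    neighbourhood-singleton-or-atom : {x : U} → Clique R (R ⟨ x ⟩) →
      (R ⟨ x ⟩ ≐ ｛ x ｝) ⊎ IsAtom R (∅ , R ⟨ x ⟩)
    neighbourhood-singleton-or-atom {x} clique with em {R ⟨ x ⟩ ≐ ｛ x ｝}
    ... | yes R⟨x⟩≐｛x｝ = inj₁ R⟨x⟩≐｛x｝
    ... | no R⟨x⟩≠｛x｝ =
      inj₂ (∅-clique-isAtom clique (x , R-refl x) (neighbourhood∈RS R⟨x⟩≠｛x｝))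

    exact⇒singleton-or-uniqueAtom : {x : U} → Clique R (R ⟨ x ⟩) → Exact (R ⟨ x ⟩) →
      (R ⟨ x ⟩ ≐ ｛ x ｝) ⊎ UniqueAtomBelow (∅ , R ⟨ x ⟩) (approx (R ⟨ x ⟩))
    exact⇒singleton-or-uniqueAtom {x} clique exact =
      Sum.map₂ (λ atom → atom , ((λ _ ()) , ⊆-↑ (R ⟨ x ⟩)) , only atom)
               (neighbourhood-singleton-or-atom clique)
      where
        only : IsAtom R (∅ , R ⟨ x ⟩) →
               ∀ p → IsAtom R p → p ≤ₚ approx (R ⟨ x ⟩) → p ≐ₚ (∅ , R ⟨ x ⟩)
        only R⟨x⟩-atom _ p-atom (_ , Q⊆↑) = atom-upper⊆clique⇒≐ clique R⟨x⟩-atom p-atom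
          (λ z → exact⇒upperClosed exact z ∘ Q⊆↑ z)

module InducedTolerance {U I : Set} (H : I → Subset U) (covering : IsCovering H) where

  R : U → U → Set
  R = induced H

  induced-refl : ∀ u → R u u
  induced-refl u = let (i , ui) = proj₂ covering u in i , ui , ui

  induced-sym : ∀ {u v} → R u v → R v u
  induced-sym (i , ui , vi) = i , vi , ui

  open Tolerance R induced-refl induced-sym public

  member-clique : ∀ i → Clique R (H i)
  member-clique i u v ui vi = i , ui , vi

  Private : I → U → Set
  Private i z = z ∈ H i × (∀ j → z ∈ H j → j ≡ i)

  private⇒neighbourhood≐member : ∀ {i z} → Private i z → R ⟨ z ⟩ ≐ H i
  private⇒neighbourhood≐member {i} {z} (zi , only-i) =
    (λ { u (j , zj , uj) → subst (λ k → u ∈ H k) (only-i j zj) uj })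
    , λ u ui → member-clique i z u zi ui

  module _ (em : ExcludedMiddle 0ℓ) (irredundant : ∀ i → ¬ (∀ u → ∃ λ j → ¬ (j ≡ i) × u ∈ H j))
    where

    private-point : ∀ i → ∃ (Private i)
    private-point i =
      let (z , not-elsewhere) = em⇒dne em λ no-private →
            irredundant i λ u → em⇒dne em λ not-elsewhere → no-private (u , not-elsewhere)
          only-i j zj = em⇒dne em λ j≠i → not-elsewhere (j , j≠i , zj)
          (k , zk) = proj₂ covering z
      in z , subst (λ j → z ∈ H j) (only-i k zk) zk , only-i

    member-singleton-or-atom : ∀ i → (∃ λ z → H i ≐ ｛ z ｝) ⊎ IsAtom R (∅ , H i)
    member-singleton-or-atom i =
      let (z , z-private@(zi , _)) = private-point i
          R⟨z⟩≐Hi = private⇒neighbourhood≐member z-private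
          R⟨z⟩-clique u v zu zv = member-clique i u v (proj₁ R⟨z⟩≐Hi u zu) (proj₁ R⟨z⟩≐Hi v zv)
      in Sum.map (λ R⟨z⟩≐｛z｝ → z , ≐-trans (≐-sym R⟨z⟩≐Hi) R⟨z⟩≐｛z｝)
                 (λ (R⟨z⟩∈RS , _) → ∅-clique-isAtom em (member-clique i) (z , zi)
                                       (InRS-resp-upper (≐-sym R⟨z⟩≐Hi) R⟨z⟩∈RS))
                 (neighbourhood-singleton-or-atom em R⟨z⟩-clique)

    atoms-below⇒upperClosed : {X : Subset U} →
      (∀ p → IsAtom R p → p ≤ₚ approx X → p ≐ₚ (∅ , X)) → UpperClosed X
    atoms-below⇒upperClosed {X} only-atom w (y , (i , wi , yi) , yX)
      with member-singleton-or-atom i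
    ... | inj₁ (_ , Hi⊆｛z｝ , _) = subst (_∈ X) (trans (Hi⊆｛z｝ y yi) (sym (Hi⊆｛z｝ w wi))) yX
    ... | inj₂ atom = proj₁ (proj₂ (only-atom (∅ , H i) atom Hi≤approxX)) w wi
      where
        Hi≤approxX : (∅ , H i) ≤ₚ approx X
        Hi≤approxX = (λ _ ()) , λ u ui → y , member-clique i u y ui yi , yX

    singleton-or-uniqueAtom⇒upperClosed : {x : U} →
      (R ⟨ x ⟩ ≐ ｛ x ｝) ⊎ UniqueAtomBelow (∅ , R ⟨ x ⟩) (approx (R ⟨ x ⟩)) →
      UpperClosed (R ⟨ x ⟩)
    singleton-or-uniqueAtom⇒upperClosed (inj₁ singleton) = singleton-upperClosed singleton
    singleton-or-uniqueAtom⇒upperClosed (inj₂ (_ , _ , only-atom)) =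
      atoms-below⇒upperClosed only-atom

lemma3p8 : ExcludedMiddle 0ℓ → {U I : Set} (H : I → Subset U) → IsIrredundantCovering H
         → (x : U) → IsBlock (induced H) (induced H ⟨ x ⟩)
         → let R = induced H
               Rx = R ⟨ x ⟩
               a = ∀ y → y ∈ Rx → R ⟨ y ⟩ ≐ Rx
               b = ((Rx ↓[ R ]) , (Rx ↑[ R ])) ≐ₚ (Rx , Rx)
               c = (Rx ≐ ｛ x ｝)
                   ⊎ (IsAtom R (∅ , Rx) × ((∅ , Rx) ≤ₚ ((Rx ↓[ R ]) , (Rx ↑[ R ])))
                      × (∀ p → IsAtom R p → p ≤ₚ ((Rx ↓[ R ]) , (Rx ↑[ R ])) → p ≐ₚ (∅ , Rx)))
           in (a ⇔ b) × (b ⇔ c)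
lemma3p8 em H (covering , irredundant) x (_ , clique , _) =
    mk⇔ (upperClosed⇒exact ∘ neighbours-equal⇒upperClosed)
        (upperClosed⇒neighbours-equal clique ∘ exact⇒upperClosed)
  , mk⇔ (exact⇒singleton-or-uniqueAtom em clique)
        (upperClosed⇒exact ∘ singleton-or-uniqueAtom⇒upperClosed em irredundant)
  where open InducedTolerance H covering
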